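{- Let $(A,\mathbf{C}^t_A)$ and $(B,\mathbf{C}^t_B)$ be tangled closure algebras with induced closure operators $\mathbf{C}_A$ and $\mathbf{C}_B$, and let $f:A\to B$ be a Boolean algebra homomorphism with $f(\mathbf{C}_Aa)=\mathbf{C}_Bf(a)$ for all $a\in A$. Suppose $A$ is finite. Then $f(\mathbf{C}^t_A\varGamma)=\mathbf{C}^t_B\{f\gamma:\gamma\in\varGamma\}$ for every non-empty $\varGamma\subseteq A$.
   Context: A Boolean algebra $A$ has operations $\land,\lor,-,0,1$; $a\Rightarrow b=-a\lor b$. A closure operator on $A$ is $\mathbf{C}:A\to A$ with $\mathbf{C}(a\lor b)=\mathbf{C}a\lor\mathbf{C}b$, $\mathbf{C}0=0$, $a\leq\mathbf{C}a=\mathbf{C}\mathbf{C}a$; interior $\mathbf{I}a=-\mathbf{C}-a$. $\mathcal{P}_{fin}A$ is the set of finite non-empty subsets of $A$. For $\mathbf{C}^t:\mathcal{P}_{fin}A\to A$, the induced $\mathbf{C}a=\mathbf{C}^t\{a\}$, $\mathbf{I}a=-\mathbf{C}^t\{ -a\}$; $(A,\mathbf{C}^t)$ is a tangled closure algebra if $\mathbf{C}$ is a closure operator and for all $\varGamma\in\mathcal{P}_{fin}A$, $a\in A$: (Fix) $\mathbf{C}^t\varGamma\leq\bigwedge_{\gamma\in\varGamma}\mathbf{C}(\gamma\land\mathbf{C}^t\varGamma)$; (Ind) $\mathbf{I}(a\Rightarrow\bigwedge_{\gamma\in\varGamma}\mathbf{C}(\gamma\land a))\land a\leq\mathbf{C}^t\varGamma$.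 -}

module Defs where

open import Level using (Level; _⊔_; suc)
open import Data.Product using (Σ; _×_; _,_)
open import Data.List using (List)
open import Data.List.NonEmpty using (List⁺; toList; foldr₁; [_]) renaming (map to map⁺)
import Data.List.Membership.Setoid as SetoidMembership
open import Algebra.Lattice.Bundles using (BooleanAlgebra)
open import Algebra.Lattice.Morphism.Structures using (IsLatticeHomomorphism)

module BAOps {c ℓ : Level} (B : BooleanAlgebra c ℓ) where
  open BooleanAlgebra B

  _≤_ : Carrier → Carrier → Set ℓ
  a ≤ b = (a ∧ b) ≈ a

  _⇒_ : Carrier → Carrier → Carrier
  a ⇒ b = (¬ a) ∨ b

  ⋀ : List⁺ Carrier → Carrier
  ⋀ = foldr₁ _∧_

  open SetoidMembership setoid public using (_∈_)

  SameSet : List⁺ Carrier → List⁺ Carrier → Set (c ⊔ ℓ)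
  SameSet xs ys = (∀ x → x ∈ toList xs → x ∈ toList ys)
                × (∀ x → x ∈ toList ys → x ∈ toList xs)

  IsFinite : Set (c ⊔ ℓ)
  IsFinite = Σ (List Carrier) λ xs → ∀ a → a ∈ xs

  Cof : (List⁺ Carrier → Carrier) → Carrier → Carrier
  Cof Ct a = Ct [ a ]

  Iof : (List⁺ Carrier → Carrier) → Carrier → Carrier
  Iof Ct a = ¬ (Ct [ ¬ a ])

  -- (B, Ct) is a tangled closure algebra.  Finite non-empty subsets of the
  -- carrier are represented by non-empty lists; Ct must only depend on the
  -- set of elements (Ct-cong).
  record IsTangledClosure (Ct : List⁺ Carrier → Carrier) : Set (c ⊔ ℓ) where
    C = Cof Ct
    I = Iof Ct
    field
      Ct-cong : ∀ Γ Δ → SameSet Γ Δ → Ct Γ ≈ Ct Δ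
      C-∨     : ∀ a b → C (a ∨ b) ≈ (C a ∨ C b)
      C-⊥     : C ⊥ ≈ ⊥
      C-infl  : ∀ a → a ≤ C a
      C-idem  : ∀ a → C a ≈ C (C a)
      fix : ∀ Γ → Ct Γ ≤ ⋀ (map⁺ (λ γ → C (γ ∧ Ct Γ)) Γ)
      ind : ∀ Γ a → (I (a ⇒ ⋀ (map⁺ (λ γ → C (γ ∧ a)) Γ)) ∧ a) ≤ Ct Γ

record TangledClosureAlgebra (c ℓ : Level) : Set (suc (c ⊔ ℓ)) where
  field
    booleanAlgebra : BooleanAlgebra c ℓ
    Ct : List⁺ (BooleanAlgebra.Carrier booleanAlgebra) → BooleanAlgebra.Carrier booleanAlgebra
    isTangledClosure : BAOps.IsTangledClosure booleanAlgebra Ct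

  C : BooleanAlgebra.Carrier booleanAlgebra → BooleanAlgebra.Carrier booleanAlgebra
  C = BAOps.Cof booleanAlgebra Ct

record IsBooleanAlgebraHomomorphism {c₁ ℓ₁ c₂ ℓ₂ : Level}
         (A : BooleanAlgebra c₁ ℓ₁) (B : BooleanAlgebra c₂ ℓ₂)
         (f : BooleanAlgebra.Carrier A → BooleanAlgebra.Carrier B)
         : Set (c₁ ⊔ ℓ₁ ⊔ ℓ₂) where
  module A = BooleanAlgebra A
  module B = BooleanAlgebra B
  field
    isLatticeHomomorphism : IsLatticeHomomorphism A.rawLattice B.rawLattice f
    ¬-homo : ∀ a → f (A.¬ a) B.≈ (B.¬ f a)
    ⊤-homo : f A.⊤ B.≈ B.⊤
    ⊥-homo : f A.⊥ B.≈ B.⊥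

-- For a tangled closure algebra (A, Cᵗ) and Γ ∈ 𝒫_fin A put
--   Φ_Γ(a) = ⋀_{γ∈Γ} C(γ ∧ a).
-- Φ_Γ is monotone; (Fix) says that Cᵗ Γ is a post-fixed point of Φ_Γ and
-- (Ind) says that every post-fixed point lies below Cᵗ Γ.  So Cᵗ Γ is the
-- greatest post-fixed point of Φ_Γ and lies below every iterate Φ_Γⁿ(⊤).
-- These iterates decrease; if A is finite two of them coincide, so some
-- iterate is itself a post-fixed point and hence Cᵗ Γ = Φ_Γᵐ(⊤).
--
-- A Boolean homomorphism f commuting with C commutes with Φ, i.e.
-- f(Φ_Γ a) = Φ_{fΓ}(f a).  It therefore maps post-fixed points to post-fixed
-- points, giving f(Cᵗ Γ) ≤ Cᵗ(fΓ) in general, and it maps iterates to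
-- iterates, giving Cᵗ(fΓ) ≤ Φ_{fΓ}ᵐ(⊤) = f(Φ_Γᵐ ⊤) = f(Cᵗ Γ) when A is finite.
module Submission where

open import Defs
open import Level using (Level)
open import Data.List.NonEmpty using (List⁺; _∷_) renaming (map to map⁺)
open import Algebra.Lattice.Bundles using (BooleanAlgebra)
open import Data.List using (List; []; _∷_; length; lookup)
open import Data.List.NonEmpty.Properties using (map-∘)
open import Data.List.Relation.Unary.Any using (here; index)
open import Data.List.Relation.Unary.Any.Properties using (lookup-index)
open import Data.Product using (∃; ∃₂; _×_; _,_)
open import Data.Nat using (ℕ; zero; suc; z≤n; s≤s) renaming (_≤_ to _≤ℕ_; _<_ to _<ℕ_)
open import Data.Nat.Properties using (n<1+n)
open import Data.Fin using (Fin; toℕ)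
open import Data.Fin.Properties using (pigeonhole)
open import Relation.Binary.Bundles using (Setoid)
open import Relation.Binary.PropositionalEquality using (cong) renaming (sym to ≡-sym)
open import Algebra.Lattice.Morphism.Structures using (module IsLatticeHomomorphism)
import Data.List.Membership.Setoid as SetoidMembership

-- The meet order a ⊑ b ⟺ a ≈ a ∧ b of a Boolean algebra, taken from the
-- library's order-theoretic meet semilattice.  The relation _≤_ of Defs is
-- the same order written the other way round.
module MeetOrder {c ℓ : Level} (B : BooleanAlgebra c ℓ) where
  open BooleanAlgebra B
  open BAOps B using (_≤_; _⇒_; ⋀)
  open import Algebra.Lattice.Properties.BooleanAlgebra B
    using (∧-orderTheoreticMeetSemilattice; ∧-identityˡ; ∧-identityʳ)
  open import Relation.Binary.Lattice using (MeetSemilattice)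
  open MeetSemilattice ∧-orderTheoreticMeetSemilattice public
    using (poset)
    renaming (_≤_ to _⊑_; refl to ⊑-refl; reflexive to ⊑-reflexive;
              trans to ⊑-trans; antisym to ⊑-antisym)
  open import Relation.Binary.Lattice.Properties.MeetSemilattice
    ∧-orderTheoreticMeetSemilattice public using (∧-monotonic)
  open import Relation.Binary.Reasoning.Setoid setoid

  ≤⇒⊑ : ∀ {a b} → a ≤ b → a ⊑ b
  ≤⇒⊑ = sym

  ⊑-⊤ : ∀ a → a ⊑ ⊤
  ⊑-⊤ a = sym (∧-identityʳ a)

  x⊑x∨y : ∀ a b → a ⊑ a ∨ b
  x⊑x∨y a b = sym (∧-absorbs-∨ a b)

  ⊑⇒∨≈ : ∀ {a b} → a ⊑ b → a ∨ b ≈ b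
  ⊑⇒∨≈ {a} {b} a⊑b = begin
    a ∨ b       ≈⟨ ∨-congʳ a⊑b ⟩
    (a ∧ b) ∨ b ≈⟨ ∨-comm (a ∧ b) b ⟩
    b ∨ (a ∧ b) ≈⟨ ∨-congˡ (∧-comm a b) ⟩
    b ∨ (b ∧ a) ≈⟨ ∨-absorbs-∧ b a ⟩
    b           ∎

  ⊑⇒⇒≈⊤ : ∀ {a b} → a ⊑ b → (a ⇒ b) ≈ ⊤
  ⊑⇒⇒≈⊤ {a} {b} a⊑b = begin
    ¬ a ∨ b               ≈⟨ ∧-identityˡ (¬ a ∨ b) ⟨
    ⊤ ∧ (¬ a ∨ b)         ≈⟨ ∧-congʳ (∨-complementˡ a) ⟨
    (¬ a ∨ a) ∧ (¬ a ∨ b) ≈⟨ ∨-distribˡ-∧ (¬ a) a b ⟨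
    ¬ a ∨ (a ∧ b)         ≈⟨ ∨-congˡ a⊑b ⟨
    ¬ a ∨ a               ≈⟨ ∨-complementˡ a ⟩
    ⊤                     ∎

  ⋀-map-mono : ∀ {a} {X : Set a} {g h : X → Carrier} →
               (∀ x → g x ⊑ h x) → ∀ xs → ⋀ (map⁺ g xs) ⊑ ⋀ (map⁺ h xs)
  ⋀-map-mono {g = g} {h} g⊑h (x ∷ xs) = go x xs
    where
    go : ∀ x xs → ⋀ (map⁺ g (x ∷ xs)) ⊑ ⋀ (map⁺ h (x ∷ xs))
    go x []       = g⊑h x
    go x (y ∷ ys) = ∧-monotonic (g⊑h x) (go y ys)

  ⋀-map-cong : ∀ {a} {X : Set a} {g h : X → Carrier} →
               (∀ x → g x ≈ h x) → ∀ xs → ⋀ (map⁺ g xs) ≈ ⋀ (map⁺ h xs)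
  ⋀-map-cong g≈h xs = ⊑-antisym (⋀-map-mono (λ x → ⊑-reflexive (g≈h x)) xs)
                                (⋀-map-mono (λ x → ⊑-reflexive (sym (g≈h x))) xs)

-- In a setoid enumerated by a list, every ℕ-indexed sequence repeats
-- itself up to ≈ (pigeonhole on the positions in the enumeration).
module Enumeration {c ℓ : Level} (S : Setoid c ℓ) where
  open Setoid S
  open SetoidMembership S using (_∈_)

  sequence-repeats : (xs : List Carrier) → (∀ a → a ∈ xs) → (s : ℕ → Carrier) →
                     ∃₂ λ i j → i <ℕ j × s i ≈ s j
  sequence-repeats xs enum s with pigeonhole (n<1+n (length xs)) position
    where
    position : Fin (suc (length xs)) → Fin (length xs)
    position i = index (enum (s (toℕ i)))
  ... | i , j , i<j , same-position = toℕ i , toℕ j , i<j ,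
    trans (lookup-index (enum (s (toℕ i))))
          (sym (trans (lookup-index (enum (s (toℕ j))))
                      (reflexive (cong (lookup xs) (≡-sym same-position)))))

module TangledClosureFacts {c ℓ : Level} (𝔄 : TangledClosureAlgebra c ℓ) where
  open TangledClosureAlgebra 𝔄 using (booleanAlgebra; Ct; isTangledClosure)
  open BooleanAlgebra booleanAlgebra
  open BAOps booleanAlgebra using (_⇒_; ⋀; _∈_; IsFinite; module IsTangledClosure)
  open IsTangledClosure isTangledClosure
  open MeetOrder booleanAlgebra
  open import Algebra.Lattice.Properties.BooleanAlgebra booleanAlgebra using (¬⊤≈⊥; ¬⊥≈⊤; ∧-identityˡ)
  open import Relation.Binary.Reasoning.PartialOrder poset

  -- Cᵗ respects the set denoted by a list, so C = Cᵗ{_} respects ≈.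
  C-cong : ∀ {a b} → a ≈ b → C a ≈ C b
  C-cong a≈b = Ct-cong _ _ ((λ _ → singleton a≈b) , (λ _ → singleton (sym a≈b)))
    where
    singleton : ∀ {a b x} → a ≈ b → x ∈ (a ∷ []) → x ∈ (b ∷ [])
    singleton a≈b (here x≈a) = here (trans x≈a a≈b)

  -- Additivity of C makes it monotone.
  C-mono : ∀ {a b} → a ⊑ b → C a ⊑ C b
  C-mono {a} {b} a⊑b = begin
    C a       ≤⟨ x⊑x∨y (C a) (C b) ⟩
    C a ∨ C b ≈⟨ C-∨ a b ⟨
    C (a ∨ b) ≈⟨ C-cong (⊑⇒∨≈ a⊑b) ⟩
    C b       ∎

  -- Normality C ⊥ ≈ ⊥ means the interior of ⊤ is ⊤; this turns a valid
  -- implication in (Ind) into a vacuous hypothesis.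
  I-⊤ : I ⊤ ≈ ⊤
  I-⊤ = trans (¬-cong (trans (C-cong ¬⊤≈⊥) C-⊥)) ¬⊥≈⊤

  -- The operator whose greatest post-fixed point is Cᵗ Γ.
  Φ : List⁺ Carrier → Carrier → Carrier
  Φ Γ a = ⋀ (map⁺ (λ γ → C (γ ∧ a)) Γ)

  Φ-cong : ∀ Γ {a b} → a ≈ b → Φ Γ a ≈ Φ Γ b
  Φ-cong Γ a≈b = ⋀-map-cong (λ γ → C-cong (∧-congˡ a≈b)) Γ

  Φ-mono : ∀ Γ {a b} → a ⊑ b → Φ Γ a ⊑ Φ Γ b
  Φ-mono Γ a⊑b = ⋀-map-mono (λ γ → C-mono (∧-monotonic ⊑-refl a⊑b)) Γ

  Ct-postfixed : ∀ Γ → Ct Γ ⊑ Φ Γ (Ct Γ)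
  Ct-postfixed Γ = ≤⇒⊑ (fix Γ)

  postfixed⇒⊑Ct : ∀ Γ {a} → a ⊑ Φ Γ a → a ⊑ Ct Γ
  postfixed⇒⊑Ct Γ {a} a⊑Φa = begin
    a                     ≈⟨ ∧-identityˡ a ⟨
    ⊤ ∧ a                 ≈⟨ ∧-congʳ (trans (¬-cong (C-cong (¬-cong (⊑⇒⇒≈⊤ a⊑Φa)))) I-⊤) ⟨
    I (a ⇒ Φ Γ a) ∧ a     ≤⟨ ≤⇒⊑ (ind Γ a) ⟩
    Ct Γ                  ∎

  iterate : List⁺ Carrier → ℕ → Carrier
  iterate Γ zero    = ⊤
  iterate Γ (suc n) = Φ Γ (iterate Γ n)

  Ct⊑iterate : ∀ Γ n → Ct Γ ⊑ iterate Γ n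
  Ct⊑iterate Γ zero    = ⊑-⊤ (Ct Γ)
  Ct⊑iterate Γ (suc n) = ⊑-trans (Ct-postfixed Γ) (Φ-mono Γ (Ct⊑iterate Γ n))

  iterate-antitone : ∀ Γ {m n} → m ≤ℕ n → iterate Γ n ⊑ iterate Γ m
  iterate-antitone Γ {zero}  {n}     z≤n     = ⊑-⊤ (iterate Γ n)
  iterate-antitone Γ {suc m} {suc n} (s≤s p) = Φ-mono Γ (iterate-antitone Γ p)

  -- In a finite algebra the descending iterates stabilise, and the stable
  -- value is Cᵗ Γ.
  Ct-is-iterate : IsFinite → ∀ Γ → ∃ λ m → Ct Γ ≈ iterate Γ m
  Ct-is-iterate (xs , enum) Γ with Enumeration.sequence-repeats setoid xs enum (iterate Γ)
  ... | m , n , m<n , sₘ≈sₙ = m , ⊑-antisym (Ct⊑iterate Γ m) (postfixed⇒⊑Ct Γ iterate-postfixed)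
    where
    iterate-postfixed : iterate Γ m ⊑ Φ Γ (iterate Γ m)
    iterate-postfixed = begin
      iterate Γ m       ≈⟨ sₘ≈sₙ ⟩
      iterate Γ n       ≤⟨ iterate-antitone Γ m<n ⟩
      iterate Γ (suc m) ∎

module ClosureHomomorphism {c₁ ℓ₁ c₂ ℓ₂ : Level}
    (𝔄 : TangledClosureAlgebra c₁ ℓ₁) (𝔅 : TangledClosureAlgebra c₂ ℓ₂)
    (f : BooleanAlgebra.Carrier (TangledClosureAlgebra.booleanAlgebra 𝔄)
       → BooleanAlgebra.Carrier (TangledClosureAlgebra.booleanAlgebra 𝔅))
    (hom : IsBooleanAlgebraHomomorphism (TangledClosureAlgebra.booleanAlgebra 𝔄)
             (TangledClosureAlgebra.booleanAlgebra 𝔅) f)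
    (f-C : ∀ a → BooleanAlgebra._≈_ (TangledClosureAlgebra.booleanAlgebra 𝔅)
                   (f (TangledClosureAlgebra.C 𝔄 a)) (TangledClosureAlgebra.C 𝔅 (f a)))
    where
  module 𝔸 = TangledClosureAlgebra 𝔄
  module 𝔹 = TangledClosureAlgebra 𝔅
  module A = BooleanAlgebra 𝔸.booleanAlgebra
  module FA = TangledClosureFacts 𝔄
  module FB = TangledClosureFacts 𝔅
  module OA = MeetOrder 𝔸.booleanAlgebra
  open BooleanAlgebra 𝔹.booleanAlgebra
  open BAOps 𝔹.booleanAlgebra using (⋀)
  open BAOps 𝔸.booleanAlgebra using () renaming (⋀ to ⋀ᴬ)
  open MeetOrder 𝔹.booleanAlgebra
  open IsLatticeHomomorphism (IsBooleanAlgebraHomomorphism.isLatticeHomomorphism hom)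
    public using (∧-homo) renaming (⟦⟧-cong to f-cong)
  open import Relation.Binary.Reasoning.PartialOrder poset

  f-mono : ∀ {a b} → a OA.⊑ b → f a ⊑ f b
  f-mono {a} {b} a⊑b = trans (f-cong a⊑b) (∧-homo a b)

  f-⋀-map : ∀ {a} {X : Set a} (g : X → A.Carrier) → ∀ xs →
            f (⋀ᴬ (map⁺ g xs)) ≈ ⋀ (map⁺ (λ x → f (g x)) xs)
  f-⋀-map g (x ∷ xs) = go x xs
    where
    go : ∀ x xs → f (⋀ᴬ (map⁺ g (x ∷ xs))) ≈ ⋀ (map⁺ (λ x → f (g x)) (x ∷ xs))
    go x []       = refl
    go x (y ∷ ys) = trans (∧-homo (g x) _) (∧-congˡ (go y ys))

  f-Φ : ∀ Γ a → f (FA.Φ Γ a) ≈ FB.Φ (map⁺ f Γ) (f a)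
  f-Φ Γ a = begin-equality
    f (FA.Φ Γ a)                                   ≈⟨ f-⋀-map (λ γ → 𝔸.C (γ A.∧ a)) Γ ⟩
    ⋀ (map⁺ (λ γ → f (𝔸.C (γ A.∧ a))) Γ)           ≈⟨ ⋀-map-cong f-C-∧ Γ ⟩
    ⋀ (map⁺ (λ γ → 𝔹.C (f γ ∧ f a)) Γ)             ≡⟨ cong ⋀ (map-∘ Γ) ⟩
    FB.Φ (map⁺ f Γ) (f a)                          ∎
    where
    f-C-∧ : ∀ γ → f (𝔸.C (γ A.∧ a)) ≈ 𝔹.C (f γ ∧ f a)
    f-C-∧ γ = trans (f-C (γ A.∧ a)) (FB.C-cong (∧-homo γ a))

  f-iterate : ∀ Γ n → f (FA.iterate Γ n) ≈ FB.iterate (map⁺ f Γ) n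
  f-iterate Γ zero    = IsBooleanAlgebraHomomorphism.⊤-homo hom
  f-iterate Γ (suc n) = trans (f-Φ Γ (FA.iterate Γ n)) (FB.Φ-cong (map⁺ f Γ) (f-iterate Γ n))

  -- Without finiteness: f maps the post-fixed point Cᵗ Γ to a post-fixed
  -- point of Φ_{fΓ}, hence below Cᵗ(fΓ).
  f-Ct⊑Ct : ∀ Γ → f (𝔸.Ct Γ) ⊑ 𝔹.Ct (map⁺ f Γ)
  f-Ct⊑Ct Γ = FB.postfixed⇒⊑Ct (map⁺ f Γ) (begin
    f (𝔸.Ct Γ)                    ≤⟨ f-mono (FA.Ct-postfixed Γ) ⟩
    f (FA.Φ Γ (𝔸.Ct Γ))           ≈⟨ f-Φ Γ (𝔸.Ct Γ) ⟩
    FB.Φ (map⁺ f Γ) (f (𝔸.Ct Γ))  ∎)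

theorem3p2 : {c₁ ℓ₁ c₂ ℓ₂ : Level}
    (𝔄 : TangledClosureAlgebra c₁ ℓ₁) (𝔅 : TangledClosureAlgebra c₂ ℓ₂)
    (f : BooleanAlgebra.Carrier (TangledClosureAlgebra.booleanAlgebra 𝔄)
       → BooleanAlgebra.Carrier (TangledClosureAlgebra.booleanAlgebra 𝔅))
    → IsBooleanAlgebraHomomorphism (TangledClosureAlgebra.booleanAlgebra 𝔄)
        (TangledClosureAlgebra.booleanAlgebra 𝔅) f
    → (∀ a → BooleanAlgebra._≈_ (TangledClosureAlgebra.booleanAlgebra 𝔅)
               (f (TangledClosureAlgebra.C 𝔄 a)) (TangledClosureAlgebra.C 𝔅 (f a)))
    → BAOps.IsFinite (TangledClosureAlgebra.booleanAlgebra 𝔄)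
    → (Γ : List⁺ (BooleanAlgebra.Carrier (TangledClosureAlgebra.booleanAlgebra 𝔄)))
    → BooleanAlgebra._≈_ (TangledClosureAlgebra.booleanAlgebra 𝔅)
        (f (TangledClosureAlgebra.Ct 𝔄 Γ)) (TangledClosureAlgebra.Ct 𝔅 (map⁺ f Γ))
theorem3p2 𝔄 𝔅 f hom f-C finite Γ with TangledClosureFacts.Ct-is-iterate 𝔄 finite Γ
... | m , Ct≈iterate = ⊑-antisym (f-Ct⊑Ct Γ) (begin
  𝔹.Ct (map⁺ f Γ)             ≤⟨ FB.Ct⊑iterate (map⁺ f Γ) m ⟩
  FB.iterate (map⁺ f Γ) m     ≈⟨ f-iterate Γ m ⟨
  f (FA.iterate Γ m)          ≈⟨ f-cong Ct≈iterate ⟨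
  f (𝔸.Ct Γ)                  ∎)
  where
  open ClosureHomomorphism 𝔄 𝔅 f hom f-C
  open MeetOrder 𝔹.booleanAlgebra using (poset; ⊑-antisym)
  open import Relation.Binary.Reasoning.PartialOrder poset
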